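{- Let $m\in\mathbb{N}$, let $\lambda$ be an $m$-adapted $d$-dimensional extractor, let $A\subseteq\{0,\ldots,m\}^d\times\mathbb{N}^d$ be a Petri net, and let $e$ be an execution of $A$. Let $I=\operatorname{extract}_{\lambda,\{1,\ldots,d\}}(e)$. There exists a word $\sigma$ obtained from $e$ by removing $I$-cycles such that $|\sigma|\le d\lambda_d^d$ and $\operatorname{src}(e)\xrightarrow{\sigma}\mathbf{c}$ for some configuration $\mathbf{c}$ satisfying $\mathbf{c}(i)=\operatorname{tgt}(e)(i)$ for every $i\in I$ and $$\mathbf{c}(i)\ge\lambda_{|I|+1}-m\sum_{j=1}^{|I|}\lambda_j^j\quad\text{for every }i\notin I.$$
   Context: Configurations are vectors of $\mathbb{N}^d$. A Petri net action is a pair $a=(\mathbf{a}_-,\mathbf{a}_+)$ of configurations; $\mathbf{x}\xrightarrow{a}\mathbf{y}$ iff $\mathbf{x}=\mathbf{a}_-+\mathbf{c}$, $\mathbf{y}=\mathbf{a}_++\mathbf{c}$ for some configuration $\mathbf{c}$; for a word $\sigma=a_1\cdots a_k$, $\mathbf{x}\xrightarrow{\sigma}\mathbf{y}$ iff there are configurations $\mathbf{c}_0=\mathbf{x},\ldots,\mathbf{c}_k=\mathbf{y}$ with $\mathbf{c}_{j-1}\xrightarrow{a_j}\mathbf{c}_j$; $|\sigma|=k$. A Petri net is a finite set of actions. A $\sigma$-execution, for $\sigma=a_1\cdots a_k$, is a word of configurations $\mathbf{c}_0\mathbf{c}_1\cdots\mathbf{c}_k$ with $\mathbf{c}_{j-1}\xrightarrow{a_j}\mathbf{c}_j$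 for all $j$; $\operatorname{src}$ and $\operatorname{tgt}$ denote $\mathbf{c}_0$ and $\mathbf{c}_k$; an execution of $A$ is a $\sigma$-execution with $\sigma\in A^*$. An execution $e$ is $I$-cyclic if $\operatorname{src}(e)|_I=\operatorname{tgt}(e)|_I$ ($|_I$ restriction to components in $I$). A word $a_1\cdots a_k$ of actions of $A$ is obtained from an execution $e$ of $A$ by removing $I$-cycles if $e$ is a concatenation $e_0e_1\cdots e_k$ of $I$-cyclic executions with $\operatorname{tgt}(e_{j-1})\xrightarrow{a_j}\operatorname{src}(e_j)$ for $1\le j\le k$. A $d$-dimensional extractor is a non-decreasing sequence $\lambda=(\lambda_0\le\cdots\le\lambda_{d+1})$ of positive natural numbers; it is $m$-adapted if $\lambda_{n+1}\ge\lambda_n+m\lambda_n^n$ for every $n\in\{0,\ldots,d\}$. For $I\subseteq\{1,\ldots,d\}$ and $\mathbf{C}\subseteq\mathbb{N}^d$, a $(\lambda,I)$-small set of $\mathbf{C}$ is $J\subseteq I$ with $\mathbf{c}(j)<\lambda_{|J|}$ for all $j\in J$, $\mathbf{c}\in\mathbf{C}$; $\operatorname{extract}_{\lambda,I}(\mathbf{C})$ is the maximum such set for inclusion (the class is nonempty and closed under union). For finite words of configurations, $\operatorname{extract}_{\lambda,I}(\varepsilon)=I$ and $\operatorname{extract}_{\lambda,I}(e\mathbf{c})=\operatorname{extract}_{\lambda,J}(\{\mathbf{c}\})$ where $J=\operatorname{extract}_{\lambda,I}(e)$. -}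

module Defs where

open import Data.Nat using (ℕ; zero; suc; _+_; _*_; _^_; _≤_; _<_)
open import Data.Fin using (Fin)
open import Data.Fin.Subset using (Subset; _⊆_; ∣_∣) renaming (_∈_ to _∈ₛ_)
open import Data.List using (List; []; _∷_; _∷ʳ_)
open import Data.List.NonEmpty using (List⁺; head; tail; last; _⁺++⁺_)
open import Data.List.Membership.Propositional using (_∈_)
open import Data.Product using (∃; _×_)
open import Relation.Binary.PropositionalEquality using (_≡_)

Config : ℕ → Set
Config d = Fin d → ℕ

record Action (d : ℕ) : Set where
  constructor _⇒_
  field
    pre  : Config d
    post : Config d
open Action public

module _ {d : ℕ} where

  Step : Action d → Config d → Config d → Set
  Step a x y = ∃ λ (c : Config d) →
    (∀ i → x i ≡ pre a i + c i) × (∀ i → y i ≡ post a i + c i)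

  data Run : List (Action d) → Config d → Config d → Set where
    run-[] : ∀ {x} → Run [] x x
    run-∷  : ∀ {a σ x y z} → Step a x y → Run σ y z → Run (a ∷ σ) x z

  data ExecFrom (A : List (Action d)) : Config d → List (Config d) → Set where
    single : ∀ {x} → ExecFrom A x []
    cons   : ∀ {a x y ys} → a ∈ A → Step a x y → ExecFrom A y ys → ExecFrom A x (y ∷ ys)

  IsExec : List (Action d) → List⁺ (Config d) → Set
  IsExec A e = ExecFrom A (head e) (tail e)

  src tgt : List⁺ (Config d) → Config d
  src = head
  tgt = last

  Cyclic : Subset d → List⁺ (Config d) → Set
  Cyclic I e = ∀ i → i ∈ₛ I → src e i ≡ tgt e i

  -- σ is obtained from e by removing I-cycles:
  -- e = e₀ e₁ ⋯ e_k with each e_j an I-cyclic execution of A,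
  -- σ = a₁ ⋯ a_k with a_j ∈ A and tgt(e_{j-1}) --a_j--> src(e_j).
  data RemovesCycles (A : List (Action d)) (I : Subset d)
       : List⁺ (Config d) → List (Action d) → Set where
    rc-end  : ∀ {e} → IsExec A e → Cyclic I e → RemovesCycles A I e []
    rc-step : ∀ {e₀ e′ a σ} → IsExec A e₀ → Cyclic I e₀ → a ∈ A →
              Step a (tgt e₀) (src e′) → RemovesCycles A I e′ σ →
              RemovesCycles A I (e₀ ⁺++⁺ e′) (a ∷ σ)

-- A d-dimensional extractor λ = (λ₀ ≤ ⋯ ≤ λ_{d+1}) of positive naturals,
-- represented as a function ℕ → ℕ of which only indices 0..d+1 matter.
Extractor : ℕ → (ℕ → ℕ) → Set
Extractor d ext =
  (∀ n → n ≤ suc d → 0 < ext n) × (∀ n → n ≤ d → ext n ≤ ext (suc n))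

Adapted : ℕ → ℕ → (ℕ → ℕ) → Set
Adapted m d ext = ∀ n → n ≤ d → ext n + m * ext n ^ n ≤ ext (suc n)

module _ {d : ℕ} where

  Small : (ℕ → ℕ) → Subset d → (Config d → Set) → Subset d → Set
  Small ext I C J = J ⊆ I × (∀ j → j ∈ₛ J → ∀ c → C c → c j < ext ∣ J ∣)

  IsExtract : (ℕ → ℕ) → Subset d → (Config d → Set) → Subset d → Set
  IsExtract ext I C J = Small ext I C J × (∀ J′ → Small ext I C J′ → J′ ⊆ J)

  data ExtractW (ext : ℕ → ℕ) (I : Subset d) : List (Config d) → Subset d → Set where
    ex-ε    : ExtractW ext I [] I
    ex-snoc : ∀ {e c J K} → ExtractW ext I e J →
              IsExtract ext J (λ c′ → c′ ≡ c) K →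
              ExtractW ext I (e ∷ʳ c) K

sumPow : (ℕ → ℕ) → ℕ → ℕ
sumPow ext zero    = 0
sumPow ext (suc n) = sumPow ext n + ext (suc n) ^ suc n

{-# OPTIONS --safe #-}
-- Walk along e, keeping the configuration s reached by the shortened word. While the extracted
-- set J stays the same, jump from the current configuration to the last one with the same
-- restriction to J (an I-cycle, as I ⊆ J) and fire the next action from s. Then s agrees with e
-- on J and, as a step consumes at most m tokens, keeps λ_{|J|+1} − m·v tokens elsewhere after
-- v steps. The restrictions to J are below λ_{|J|} and never repeat, so a phase has at most
-- λ_{|J|}^{|J|} steps, and m-adaptedness leaves enough tokens both to fire and, when a smaller
-- set is extracted, to start the next phase with λ_{|K|+1} tokens outside K.
module Submission where

open import Defs
open import Function using (_∘_; id)
open import Data.Nat using (ℕ; zero; suc; _+_; _*_; _^_; _∸_; _≤_; _<_; _≤′_; ≤′-refl; ≤′-step; z≤n; s≤s; s≤s⁻¹; >-nonZero)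
open import Data.Nat.Properties
import Data.Bool as Bool
open import Data.Fin using (Fin; zero; suc)
open import Data.Fin.Subset using (Subset; ⊤; ⁅_⁆; _∪_; ∣_∣; _∉_; _⊆_; inside; outside) renaming (_∈_ to _∈ₛ_)
open import Data.Fin.Subset.Properties using (∣p∣≤n; ∈⊤; p⊆q⇒∣p∣≤∣q∣; p⊂q⇒∣p∣<∣q∣; drop-∷-⊆; _∈?_; x∈⁅x⁆; x∈⁅y⁆⇒x≡y; x∈p∪q⁺; x∈p∪q⁻; q⊆p∪q)
open import Data.Vec using ([]; _∷_; here; there)
open import Data.Vec.Properties using () renaming (≡-dec to Vec-≡-dec)
open import Data.List using (List; []; _∷_; _++_; length; map; filter; upTo; cartesianProductWith; _∷ʳ_; initLast; _∷ʳ′_)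
open import Data.List.Properties using (∷-injectiveˡ; ∷-injectiveʳ; length-++; length-map; length-upTo; filter-notAll; length-++-≤ʳ; ++-identityʳ) renaming (≡-dec to List-≡-dec)
open import Data.List.NonEmpty using (List⁺; _∷_; last; _⁺++⁺_; toList)
open import Data.List.Membership.Propositional using (_∈_)
open import Data.List.Membership.Propositional.Properties using (∈-map⁺; ∈-upTo⁺; ∈-filter⁺; ∈-cartesianProductWith⁺)
open import Data.List.Relation.Unary.All using (All; []; _∷_)
import Data.List.Relation.Unary.All as All
open import Data.List.Relation.Unary.All.Properties using (¬Any⇒All¬)
import Data.List.Relation.Unary.Any as Any
open import Data.List.Relation.Unary.Any using (here; there)
open import Data.List.Relation.Unary.Unique.Propositional using (Unique; []; _∷_)
open import Data.Product using (∃; _×_; _,_; proj₁; proj₂)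
open import Data.Product.Properties using () renaming (≡-dec to ×-≡-dec)
open import Data.Sum using (_⊎_; inj₁; inj₂)
open import Data.Unit using () renaming (⊤ to Unit)
open import Relation.Binary.Definitions using (DecidableEquality)
open import Relation.Nullary using (¬_; Dec; yes; no; contradiction)
open import Relation.Nullary.Decidable using (¬?)
open import Relation.Binary.PropositionalEquality

last-∷ : ∀ {a} {A : Set a} (x y : A) ys → last (x ∷ y ∷ ys) ≡ last (y ∷ ys)
last-∷ x y ys with initLast ys
... | []       = refl
... | _ ∷ʳ′ _ = refl

last-⁺++⁺ : ∀ {a} {A : Set a} (xs ys : List⁺ A) → last (xs ⁺++⁺ ys) ≡ last ys
last-⁺++⁺ (x ∷ xs) (y ∷ ys) = last-++ x xs
  where
  last-++ : ∀ x xs → last (x ∷ xs ++ y ∷ ys) ≡ last (y ∷ ys)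
  last-++ x []        = last-∷ x y ys
  last-++ x (x′ ∷ xs) = trans (last-∷ x x′ (xs ++ y ∷ ys)) (last-++ x′ xs)

length-cartesianProductWith : ∀ {a b c} {A : Set a} {B : Set b} {C : Set c} (f : A → B → C) xs ys →
                              length (cartesianProductWith f xs ys) ≡ length xs * length ys
length-cartesianProductWith f []       ys = refl
length-cartesianProductWith f (x ∷ xs) ys = trans (length-++ (map (f x) ys))
  (cong₂ _+_ (length-map (f x) ys) (length-cartesianProductWith f xs ys))

module _ {a} {A : Set a} (_≟_ : DecidableEquality A) where

  length-≤-unique : ∀ {xs ys : List A} → Unique xs → All (_∈ ys) xs → length xs ≤ length ys
  length-≤-unique {[]}     _                 _                 = z≤n
  length-≤-unique {x ∷ xs} {ys} (x∉xs ∷ unique) (x∈ys ∷ xs⊆ys) = begin-strict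
    length xs                 ≤⟨ length-≤-unique unique (All.zipWith inFiltered (xs⊆ys , x∉xs)) ⟩
    length (filter ≢x? ys)    <⟨ filter-notAll ≢x? ys (Any.map (λ x≡w w≢x → w≢x (sym x≡w)) x∈ys) ⟩
    length ys                 ∎
    where
    open ≤-Reasoning
    ≢x? = λ w → ¬? (w ≟ x)
    inFiltered : ∀ {w} → w ∈ ys × x ≢ w → w ∈ filter ≢x? ys
    inFiltered (w∈ys , x≢w) = ∈-filter⁺ ≢x? w∈ys (x≢w ∘ sym)

module _ {n : ℕ} where

  Agree : Subset n → (Fin n → ℕ) → (Fin n → ℕ) → Set
  Agree J u v = ∀ j → j ∈ₛ J → u j ≡ v j

  agree-trans : ∀ {J u v w} → Agree J u v → Agree J v w → Agree J u w
  agree-trans u≈v v≈w j j∈J = trans (u≈v j j∈J) (v≈w j j∈J)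

  agree-sym : ∀ {J u v} → Agree J u v → Agree J v u
  agree-sym u≈v j j∈J = sym (u≈v j j∈J)

  agree-⊆ : ∀ {I J u v} → I ⊆ J → Agree J u v → Agree I u v
  agree-⊆ I⊆J u≈v j j∈I = u≈v j (I⊆J j∈I)

restrict : ∀ {n} → Subset n → (Fin n → ℕ) → List ℕ
restrict []            u = []
restrict (inside  ∷ J) u = u zero ∷ restrict J (u ∘ suc)
restrict (outside ∷ J) u = restrict J (u ∘ suc)

restrict-injective : ∀ {n} (J : Subset n) {u v} → restrict J u ≡ restrict J v → Agree J u v
restrict-injective (inside  ∷ J) eq zero    here       = ∷-injectiveˡ eq
restrict-injective (inside  ∷ J) eq (suc j) (there j∈J) =
  restrict-injective J (∷-injectiveʳ eq) j j∈J
restrict-injective (outside ∷ J) eq (suc j) (there j∈J) = restrict-injective J eq j j∈J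

boundedWords : ∀ {n} → Subset n → ℕ → List (List ℕ)
boundedWords []            b = [] ∷ []
boundedWords (inside  ∷ J) b = cartesianProductWith _∷_ (upTo b) (boundedWords J b)
boundedWords (outside ∷ J) b = boundedWords J b

length-boundedWords : ∀ {n} (J : Subset n) b → length (boundedWords J b) ≡ b ^ ∣ J ∣
length-boundedWords []            b = refl
length-boundedWords (inside  ∷ J) b = trans (length-cartesianProductWith _∷_ (upTo b) (boundedWords J b))
  (cong₂ _*_ (length-upTo b) (length-boundedWords J b))
length-boundedWords (outside ∷ J) b = length-boundedWords J b

restrict∈boundedWords : ∀ {n} (J : Subset n) {u b} → (∀ j → j ∈ₛ J → u j < b) →
                        restrict J u ∈ boundedWords J b
restrict∈boundedWords []            u<b = here refl
restrict∈boundedWords (inside  ∷ J) u<b = ∈-cartesianProductWith⁺ _∷_ (∈-upTo⁺ (u<b zero here))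
  (restrict∈boundedWords J (λ j j∈J → u<b (suc j) (there j∈J)))
restrict∈boundedWords (outside ∷ J) u<b = restrict∈boundedWords J (λ j j∈J → u<b (suc j) (there j∈J))

p⊆q∧p≢q⇒∣p∣<∣q∣ : ∀ {n} {p q : Subset n} → p ⊆ q → p ≢ q → ∣ p ∣ < ∣ q ∣
p⊆q∧p≢q⇒∣p∣<∣q∣ {p = []}            {[]}            _   p≢q = contradiction refl p≢q
p⊆q∧p≢q⇒∣p∣<∣q∣ {p = outside ∷ p} {outside ∷ q} p⊆q p≢q =
  p⊆q∧p≢q⇒∣p∣<∣q∣ (drop-∷-⊆ p⊆q) (p≢q ∘ cong (outside ∷_))
p⊆q∧p≢q⇒∣p∣<∣q∣ {p = outside ∷ p} {inside  ∷ q} p⊆q _   = s≤s (p⊆q⇒∣p∣≤∣q∣ (drop-∷-⊆ p⊆q))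
p⊆q∧p≢q⇒∣p∣<∣q∣ {p = inside  ∷ p} {outside ∷ q} p⊆q _   with () ← p⊆q here
p⊆q∧p≢q⇒∣p∣<∣q∣ {p = inside  ∷ p} {inside  ∷ q} p⊆q p≢q =
  s≤s (p⊆q∧p≢q⇒∣p∣<∣q∣ (drop-∷-⊆ p⊆q) (p≢q ∘ cong (inside ∷_)))

sumPow-mono : ∀ (f : ℕ → ℕ) {k n} → k ≤ n → sumPow f k ≤ sumPow f n
sumPow-mono f = mono′ ∘ ≤⇒≤′
  where
  mono′ : ∀ {k n} → k ≤′ n → sumPow f k ≤ sumPow f n
  mono′ ≤′-refl       = ≤-refl
  mono′ (≤′-step k≤n) = ≤-trans (mono′ k≤n) (m≤m+n _ _)

sumPow-+ : ∀ (f : ℕ → ℕ) {k n} → k < n → sumPow f k + f n ^ n ≤ sumPow f n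
sumPow-+ f {n = suc n} (s≤s k≤n) = +-monoˡ-≤ (f (suc n) ^ suc n) (sumPow-mono f k≤n)

^≤1+sumPow : ∀ (f : ℕ → ℕ) n → f n ^ n ≤ suc (sumPow f n)
^≤1+sumPow f zero    = ≤-refl
^≤1+sumPow f (suc n) = ≤-trans (m≤n+m _ _) (n≤1+n _)

module _ {d : ℕ} {ext : ℕ → ℕ} (extractor : Extractor d ext) where

  ext-mono : ∀ {k n} → k ≤ n → n ≤ suc d → ext k ≤ ext n
  ext-mono = mono′ ∘ ≤⇒≤′
    where
    mono′ : ∀ {k n} → k ≤′ n → n ≤ suc d → ext k ≤ ext n
    mono′ ≤′-refl       _     = ≤-refl
    mono′ (≤′-step k≤n) 1+n≤ = ≤-trans (mono′ k≤n (<⇒≤ 1+n≤)) (proj₂ extractor _ (s≤s⁻¹ 1+n≤))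

  sumPow≤ : ∀ {n} → n ≤ d → sumPow ext n ≤ n * ext d ^ d
  sumPow≤ {zero}  _   = z≤n
  sumPow≤ {suc n} n<d = begin
    sumPow ext n + ext (suc n) ^ suc n ≤⟨ +-mono-≤ (sumPow≤ (<⇒≤ n<d)) ^≤ ⟩
    n * ext d ^ d + ext d ^ d          ≡⟨ +-comm (n * ext d ^ d) (ext d ^ d) ⟩
    suc n * ext d ^ d                  ∎
    where
    open ≤-Reasoning
    instance
      ext-d≢0 = >-nonZero (proj₁ extractor d (n≤1+n d))
    ^≤ : ext (suc n) ^ suc n ≤ ext d ^ d
    ^≤ = ≤-trans (^-monoˡ-≤ (suc n) (ext-mono n<d (n≤1+n d))) (^-monoʳ-≤ (ext d) n<d)

  -- Maximality of K: otherwise K ∪ {i} would be a larger small set.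
  extract-excluded : ∀ {J K : Subset d} {y : Config d} {i} → IsExtract ext J (λ c → c ≡ y) K →
                     i ∈ₛ J → i ∉ K → ext (suc ∣ K ∣) ≤ y i
  extract-excluded {J} {K} {y} {i} ((K⊆J , K-small) , maximal) i∈J i∉K with ext (suc ∣ K ∣) ≤? y i
  ... | yes large = large
  ... | no  small = contradiction (maximal K′ K′-small i∈K′) i∉K
    where
    K′ = ⁅ i ⁆ ∪ K
    i∈K′ : i ∈ₛ K′
    i∈K′ = x∈p∪q⁺ (inj₁ (x∈⁅x⁆ i))
    ext≤ext∣K′∣ : ∀ {n} → n ≤ ∣ K′ ∣ → ext n ≤ ext ∣ K′ ∣
    ext≤ext∣K′∣ n≤ = ext-mono n≤ (m≤n⇒m≤1+n (∣p∣≤n K′))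
    K′-cases : ∀ {j} → j ∈ₛ K′ → j ≡ i ⊎ j ∈ₛ K
    K′-cases {j} j∈K′ with x∈p∪q⁻ ⁅ i ⁆ K j∈K′
    ... | inj₁ j∈⁅i⁆ = inj₁ (x∈⁅y⁆⇒x≡y i j∈⁅i⁆)
    ... | inj₂ j∈K   = inj₂ j∈K
    K′⊆J : K′ ⊆ J
    K′⊆J j∈K′ with K′-cases j∈K′
    ... | inj₁ refl = i∈J
    ... | inj₂ j∈K  = K⊆J j∈K
    below : ∀ {j} → j ≡ i ⊎ j ∈ₛ K → y j < ext ∣ K′ ∣
    below (inj₁ refl) = <-≤-trans (≰⇒> small) (ext≤ext∣K′∣ (p⊂q⇒∣p∣<∣q∣ (q⊆p∪q ⁅ i ⁆ K , i , i∈K′ , i∉K)))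
    below (inj₂ j∈K)  = <-≤-trans (K-small _ j∈K y refl) (ext≤ext∣K′∣ (p⊆q⇒∣p∣≤∣q∣ (q⊆p∪q ⁅ i ⁆ K)))
    K′-small : Small ext J (λ c → c ≡ y) K′
    K′-small = K′⊆J , λ { j j∈K′ c refl → below (K′-cases j∈K′) }

fire-agreeing : ∀ {d m} {a : Action d} {J : Subset d} {y z s : Config d} →
                (∀ i → pre a i ≤ m) → Step a y z → Agree J s y → (∀ i → i ∉ J → m ≤ s i) →
                ∃ λ s′ → Step a s s′ × Agree J s′ z × (∀ i → s i ≤ s′ i + m)
fire-agreeing {m = m} {a} {J} {z = z} {s} pre≤m (c , y≡ , z≡) s≈y m≤s =
  s′ , ((λ i → s i ∸ pre a i) , (λ i → sym (m+[n∸m]≡n (pre≤s i))) , (λ _ → refl)) , s′≈z , s≤s′+m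
  where
  s′ : Config _
  s′ i = post a i + (s i ∸ pre a i)
  pre≤s : ∀ i → pre a i ≤ s i
  pre≤s i with i ∈? J
  ... | yes i∈J = ≤-trans (m≤m+n (pre a i) (c i)) (≤-reflexive (sym (trans (s≈y i i∈J) (y≡ i))))
  ... | no  i∉J = ≤-trans (pre≤m i) (m≤s i i∉J)
  s′≈z : Agree J s′ z
  s′≈z j j∈J = begin
    post a j + (s j ∸ pre a j)           ≡⟨ cong (λ w → post a j + (w ∸ pre a j)) (trans (s≈y j j∈J) (y≡ j)) ⟩
    post a j + (pre a j + c j ∸ pre a j) ≡⟨ cong (post a j +_) (m+n∸m≡n (pre a j) (c j)) ⟩
    post a j + c j                       ≡⟨ sym (z≡ j) ⟩
    z j                                  ∎
    where open ≡-Reasoning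
  s≤s′+m : ∀ i → s i ≤ s′ i + m
  s≤s′+m i = begin
    s i                      ≡⟨ m+[n∸m]≡n (pre≤s i) ⟨
    pre a i + (s i ∸ pre a i) ≤⟨ +-mono-≤ (pre≤m i) (m≤n+m (s i ∸ pre a i) (post a i)) ⟩
    m + s′ i                  ≡⟨ +-comm m (s′ i) ⟩
    s′ i + m                  ∎
    where open ≤-Reasoning

module _ {d : ℕ} (ext : ℕ → ℕ) where

  -- The recursion of ExtractW, unfolded from the front of the word.
  data ExtractL (I : Subset d) : List (Config d) → Subset d → Set where
    []  : ExtractL I [] I
    _∷_ : ∀ {c cs J K} → IsExtract ext I (λ c′ → c′ ≡ c) J → ExtractL J cs K → ExtractL I (c ∷ cs) K

  ExtractL-∷ʳ : ∀ {I J K cs c} → ExtractL I cs J → IsExtract ext J (λ c′ → c′ ≡ c) K → ExtractL I (cs ∷ʳ c) K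
  ExtractL-∷ʳ []          ie = ie ∷ []
  ExtractL-∷ʳ (ie′ ∷ exs) ie = ie′ ∷ ExtractL-∷ʳ exs ie

  ExtractW⇒ExtractL : ∀ {I J cs} → ExtractW ext I cs J → ExtractL I cs J
  ExtractW⇒ExtractL ex-ε              = []
  ExtractW⇒ExtractL (ex-snoc exs ie) = ExtractL-∷ʳ (ExtractW⇒ExtractL exs) ie

module CycleRemoval {d : ℕ} (m : ℕ) {ext : ℕ → ℕ} (extractor : Extractor d ext) (adapted : Adapted m d ext)
                    (A : List (Action d)) (pre≤m : ∀ a → a ∈ A → ∀ i → pre a i ≤ m) where

  Bounded : Subset d → Config d → Set
  Bounded J x = ∀ j → j ∈ₛ J → x j < ext ∣ J ∣

  extract-bounded : ∀ {J K y} → IsExtract ext J (λ c → c ≡ y) K → Bounded K y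
  extract-bounded ((_ , K-small) , _) j j∈K = K-small j j∈K _ refl

  -- The execution x xs annotated with the extracted sets, J at x and I at the end.
  data Phased : Subset d → Config d → List (Config d) → Subset d → Set where
    done : ∀ {J x} → Phased J x [] J
    step : ∀ {J K I x y ys a} → a ∈ A → Step a x y → IsExtract ext J (λ c → c ≡ y) K →
           Phased K y ys I → Phased J x (y ∷ ys) I

  phased : ∀ {J x xs I} → ExecFrom A x xs → ExtractL ext J xs I → Phased J x xs I
  phased single             []          = done
  phased (cons a∈ x→y exec) (ie ∷ exs) = step a∈ x→y ie (phased exec exs)

  Phased⇒⊆ : ∀ {J x xs I} → Phased J x xs I → I ⊆ J
  Phased⇒⊆ done                            = id
  Phased⇒⊆ (step _ _ ((K⊆J , _) , _) rest) = K⊆J ∘ Phased⇒⊆ rest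

  Everywhere Later : ∀ {J x xs I} → (Subset d → Config d → Set) → Phased J x xs I → Set
  Everywhere {J} {x} P t = P J x × Later P t
  Later P done              = Unit
  Later P (step _ _ _ rest) = Everywhere P rest

  Everywhere-universal : ∀ {P : Subset d → Config d → Set} → (∀ K w → P K w) →
                         ∀ {J x xs I} (t : Phased J x xs I) → Everywhere P t
  Everywhere-universal p done              = p _ _ , _
  Everywhere-universal p (step _ _ _ rest) = p _ _ , Everywhere-universal p rest

  Everywhere-zipWith : ∀ {P Q R : Subset d → Config d → Set} → (∀ {K w} → P K w → Q K w → R K w) →
                       ∀ {J x xs I} (t : Phased J x xs I) → Everywhere P t → Everywhere Q t → Everywhere R t
  Everywhere-zipWith f done              (p , _) (q , _) = f p q , _
  Everywhere-zipWith f (step _ _ _ rest) (p , ps) (q , qs) = f p q , Everywhere-zipWith f rest ps qs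

  -- Configurations are compared only through their restriction to the current extracted set.
  Key : Set
  Key = Subset d × List ℕ

  key : Subset d → Config d → Key
  key J x = J , restrict J x

  _≟ₛ_ : DecidableEquality (Subset d)
  _≟ₛ_ = Vec-≡-dec Bool._≟_

  _≟ᵏ_ : DecidableEquality Key
  _≟ᵏ_ = ×-≡-dec _≟ₛ_ (List-≡-dec _≟_)

  keysBelow : Subset d → List Key
  keysBelow J = map (J ,_) (boundedWords J (ext ∣ J ∣))

  key∈keysBelow : ∀ {J x} → Bounded J x → key J x ∈ keysBelow J
  key∈keysBelow {J} x-bounded = ∈-map⁺ (J ,_) (restrict∈boundedWords J x-bounded)

  visits≤ : ∀ {J x vis} → Bounded J x → Unique (key J x ∷ vis) → All (_∈ keysBelow J) vis →
            suc (length vis) ≤ ext ∣ J ∣ ^ ∣ J ∣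
  visits≤ {J} {x} {vis} x-bounded unique below = begin
    length (key J x ∷ vis) ≤⟨ length-≤-unique _≟ᵏ_ unique (key∈keysBelow x-bounded ∷ below) ⟩
    length (keysBelow J)   ≡⟨ length-map (J ,_) (boundedWords J (ext ∣ J ∣)) ⟩
    length (boundedWords J (ext ∣ J ∣)) ≡⟨ length-boundedWords J (ext ∣ J ∣) ⟩
    ext ∣ J ∣ ^ ∣ J ∣       ∎
    where open ≤-Reasoning

  data LastVisit (k : Key) (P : Subset d → Config d → Set) (x : Config d) (xs : List (Config d)) (I : Subset d)
       : Set where
    lastVisit : ∀ {y rs} (ps : List (Config d)) → xs ≡ ps ++ rs → ExecFrom A x ps → last (x ∷ ps) ≡ y →
                (rest : Phased (proj₁ k) y rs I) → key (proj₁ k) y ≡ k →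
                Everywhere P rest → Later (λ K w → key K w ≢ k) rest → LastVisit k P x xs I

  lastVisit? : ∀ {J x xs I} k P (t : Phased J x xs I) → Everywhere P t →
               Everywhere (λ K w → key K w ≢ k) t ⊎ LastVisit k P x xs I
  lastVisit? {J} {x} k P done P-t with key J x ≟ᵏ k
  ... | yes refl = inj₂ (lastVisit [] refl single refl done refl P-t _)
  ... | no  x≢k  = inj₁ (x≢k , _)
  lastVisit? {J} {x} k P t@(step a∈ x→y ie rest) P-t@(_ , P-rest) with lastVisit? k P rest P-rest
  ... | inj₂ (lastVisit ps refl exec ends rest′ visit P-rest′ leaves) =
    inj₂ (lastVisit (_ ∷ ps) refl (cons a∈ x→y exec) (trans (last-∷ x _ ps) ends) rest′ visit P-rest′ leaves)
  ... | inj₁ avoided with key J x ≟ᵏ k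
  ...   | yes refl = inj₂ (lastVisit [] refl single refl t refl P-t avoided)
  ...   | no  x≢k  = inj₁ (x≢k , avoided)

  floor : Subset d → ℕ
  floor I = ext (suc ∣ I ∣) ∸ m * sumPow ext ∣ I ∣

  Shortcut : Subset d → List⁺ (Config d) → Config d → List (Action d) → Set
  Shortcut I e s σ = RemovesCycles A I e σ ×
                     ∃ λ c → Run σ s c × Agree I c (tgt e) × (∀ i → i ∉ I → floor I ≤ c i)

  Shortcut-∷ : ∀ {I e₀ e s s′ a σ} → IsExec A e₀ → Cyclic I e₀ → a ∈ A → Step a (tgt e₀) (src e) →
               Step a s s′ → Shortcut I e s′ σ → Shortcut I (e₀ ⁺++⁺ e) s (a ∷ σ)
  Shortcut-∷ {e₀ = e₀} {e} exec cyclic a∈ e₀→e s→s′ (removes , c , run , c≈tgt , high) =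
    rc-step exec cyclic a∈ e₀→e removes , c , run-∷ s→s′ run ,
    (λ i i∈I → trans (c≈tgt i i∈I) (cong (λ w → w i) (sym (last-⁺++⁺ e₀ e)))) , high

  -- s simulates x after v shortcut steps in the phase of J: each step costs at most m tokens
  -- outside J.
  record Tracking (J : Subset d) (v : ℕ) (x s : Config d) : Set where
    constructor tracking
    field
      agree : Agree J s x
      ample : ∀ i → i ∉ J → ext (suc ∣ J ∣) ≤ s i + m * v

  room : ∀ {J v} → suc v ≤ ext ∣ J ∣ ^ ∣ J ∣ → ext ∣ J ∣ + m * suc v ≤ ext (suc ∣ J ∣)
  room {J} visits = ≤-trans (+-monoʳ-≤ (ext ∣ J ∣) (*-monoʳ-≤ m visits)) (adapted ∣ J ∣ (∣p∣≤n J))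

  enabled : ∀ {J v x s} → Tracking J v x s → suc v ≤ ext ∣ J ∣ ^ ∣ J ∣ → ∀ i → i ∉ J → m ≤ s i
  enabled {J} {v} {s = s} (tracking _ ample) visits i i∉J = +-cancelʳ-≤ (m * v) m (s i) (begin
    m + m * v                  ≡⟨ *-suc m v ⟨
    m * suc v                  ≤⟨ m≤n+m (m * suc v) (ext ∣ J ∣) ⟩
    ext ∣ J ∣ + m * suc v       ≤⟨ room {J} visits ⟩
    ext (suc ∣ J ∣)             ≤⟨ ample i i∉J ⟩
    s i + m * v                ∎)
    where open ≤-Reasoning

  ample-step : ∀ {b v} {w w′ : ℕ} → b ≤ w + m * v → w ≤ w′ + m → b ≤ w′ + m * suc v
  ample-step {b} {v} {w} {w′} b≤ w≤ = begin
    b                  ≤⟨ b≤ ⟩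
    w + m * v          ≤⟨ +-monoˡ-≤ (m * v) w≤ ⟩
    w′ + m + m * v     ≡⟨ +-assoc w′ m (m * v) ⟩
    w′ + (m + m * v)   ≡⟨ cong (w′ +_) (*-suc m v) ⟨
    w′ + m * suc v     ∎
    where open ≤-Reasoning

  floor≤ : ∀ {J v x s} → Tracking J v x s → v ≤ sumPow ext ∣ J ∣ → ∀ i → i ∉ J → floor J ≤ s i
  floor≤ {J} {v} {s = s} (tracking _ ample) v≤sumPow i i∉J =
    ≤-trans (∸-monoʳ-≤ (ext (suc ∣ J ∣)) (*-monoʳ-≤ m v≤sumPow))
            (m≤n+o⇒m∸n≤o (ext (suc ∣ J ∣)) (m * v) (≤-trans (ample i i∉J) (≤-reflexive (+-comm (s i) (m * v)))))

  entering : ∀ {J K z s} → IsExtract ext J (λ c → c ≡ z) K → Agree J s z →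
             (∀ i → i ∉ J → ext (suc ∣ K ∣) ≤ s i) → Tracking K 0 z s
  entering {J} {K} {z} {s} ie@((K⊆J , _) , _) s≈z high = tracking (agree-⊆ K⊆J s≈z) ample
    where
    ample : ∀ i → i ∉ K → ext (suc ∣ K ∣) ≤ s i + m * 0
    ample i i∉K with i ∈? J
    ... | yes i∈J = ≤-trans (extract-excluded extractor ie i∈J i∉K)
                            (≤-trans (≤-reflexive (sym (s≈z i i∈J))) (m≤m+n _ _))
    ... | no  i∉J = ≤-trans (high i i∉J) (m≤m+n _ _)

  -- The room left by the adapted extractor pays both for firing and for leaving J.
  track-step : ∀ {J K v y z s a} → a ∈ A → Step a y z → IsExtract ext J (λ c → c ≡ z) K →
               Tracking J v y s → suc v ≤ ext ∣ J ∣ ^ ∣ J ∣ →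
               ∃ λ s′ → Step a s s′ × (K ≡ J × Tracking J (suc v) z s′ ⊎ ∣ K ∣ < ∣ J ∣ × Tracking K 0 z s′)
  track-step {J} {K} {v} {z = z} a∈ y→z ie tracks@(tracking s≈y ample) visits
    with fire-agreeing (pre≤m _ a∈) y→z s≈y (enabled tracks visits)
  ... | s′ , s→s′ , s′≈z , s≤s′+m = s′ , s→s′ , next (K ≟ₛ J)
    where
    ample′ : ∀ i → i ∉ J → ext (suc ∣ J ∣) ≤ s′ i + m * suc v
    ample′ i i∉J = ample-step (ample i i∉J) (s≤s′+m i)
    next : Dec (K ≡ J) → K ≡ J × Tracking J (suc v) z s′ ⊎ ∣ K ∣ < ∣ J ∣ × Tracking K 0 z s′
    next (yes refl) = inj₁ (refl , tracking s′≈z ample′)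
    next (no  K≢J)  = inj₂ (K<J , entering ie s′≈z high)
      where
      K<J : ∣ K ∣ < ∣ J ∣
      K<J = p⊆q∧p≢q⇒∣p∣<∣q∣ (proj₁ (proj₁ ie)) K≢J
      high : ∀ i → i ∉ J → ext (suc ∣ K ∣) ≤ s′ i
      high i i∉J = ≤-trans (ext-mono extractor K<J (m≤n⇒m≤1+n (∣p∣≤n J)))
        (+-cancelʳ-≤ (m * suc v) (ext ∣ J ∣) (s′ i) (≤-trans (room {J} visits) (ample′ i i∉J)))

  record Fresh {J x xs I} (vis : List Key) (t : Phased J x xs I) : Set where
    constructor fresh
    field
      unique  : Unique vis
      below   : All (_∈ keysBelow J) vis
      avoided : Everywhere (λ K w → ¬ key K w ∈ vis) t

  Fresh-[] : ∀ {J x xs I} (t : Phased J x xs I) → Fresh [] t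
  Fresh-[] t = fresh [] [] (Everywhere-universal (λ _ _ ()) t)

  Fresh-∷ : ∀ {J x y ys I vis} {t : Phased J y ys I} → Bounded J x → Unique (key J x ∷ vis) →
            All (_∈ keysBelow J) vis → Everywhere (λ K w → ¬ key K w ∈ vis) t →
            Everywhere (λ K w → key K w ≢ key J x) t → Fresh (key J x ∷ vis) t
  Fresh-∷ {t = t} x-bounded unique below avoided leaves =
    fresh unique (key∈keysBelow x-bounded ∷ below) (Everywhere-zipWith
      (λ { ∉vis ≢x (here eq) → ≢x eq ; ∉vis ≢x (there ∈vis) → ∉vis ∈vis }) t avoided leaves)

  Reduced : Subset d → Config d → List (Config d) → Subset d → ℕ → Config d → Set
  Reduced I x xs J v s = ∃ λ σ → Shortcut I (x ∷ xs) s σ × length σ + v ≤ sumPow ext ∣ J ∣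

  -- Jumping to the last visit of the key of x makes the rest of the phase avoid every visited key.
  removeCycles : ∀ fuel {J x xs I} (t : Phased J x xs I) → length xs < fuel → Bounded J x →
                 (vis : List Key) → Fresh vis t → ∀ s → Tracking J (length vis) x s →
                 Reduced I x xs J (length vis) s
  removeCycles (suc fuel) {J} {x} {I = I} t xs<fuel x-bounded vis (fresh unique below avoided) s
               tracks@(tracking s≈x ample)
    with lastVisit? (key J x) (λ K w → ¬ key K w ∈ vis) t avoided
  ... | inj₁ (x≢x , _) = contradiction refl x≢x
  ... | inj₂ (lastVisit {y} ps refl prefix ends rest visit avoided′ leaves) =
    resume rest avoided′ leaves xs<fuel
    where
    v = length vis
    x-fresh : Unique (key J x ∷ vis)
    x-fresh = ¬Any⇒All¬ vis (proj₁ avoided) ∷ unique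
    visits : suc v ≤ ext ∣ J ∣ ^ ∣ J ∣
    visits = visits≤ x-bounded x-fresh below
    y≈x : Agree J y x
    y≈x = restrict-injective J (cong proj₂ visit)
    x≈last : Agree J x (last (x ∷ ps))
    x≈last = agree-trans (agree-sym y≈x) (λ j _ → cong (λ w → w j) (sym ends))
    cyclic : Cyclic I (x ∷ ps)
    cyclic = agree-⊆ (Phased⇒⊆ t) x≈last
    tail<fuel : ∀ {z zs} → length (ps ++ z ∷ zs) < suc fuel → length zs < fuel
    tail<fuel {z} {zs} rs<fuel = ≤-trans (length-++-≤ʳ (z ∷ zs) {ps}) (s≤s⁻¹ rs<fuel)
    extend : ∀ {a z zs s′ K v′} → a ∈ A → Step a y z → Step a s s′ → Reduced I z zs K v′ s′ →
             (∀ l → l + v′ ≤ sumPow ext ∣ K ∣ → suc l + v ≤ sumPow ext ∣ J ∣) →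
             Reduced I x (ps ++ z ∷ zs) J v s
    extend {z = z} a∈ y→z s→s′ (σ , shortcut , budget) budget′ =
      _ ∷ σ , Shortcut-∷ prefix cyclic a∈ (subst (λ w → Step _ w z) (sym ends) y→z) s→s′ shortcut ,
      budget′ (length σ) budget
    resume : ∀ {rs} (rest : Phased J y rs I) → Everywhere (λ K w → ¬ key K w ∈ vis) rest →
             Later (λ K w → key K w ≢ key J x) rest → length (ps ++ rs) < suc fuel →
             Reduced I x (ps ++ rs) J v s
    resume done _ _ _ rewrite ++-identityʳ ps =
      [] , (rc-end prefix cyclic , s , run-[] , agree-trans s≈x x≈last , floor≤ tracks v≤sumPow) , v≤sumPow
      where
      v≤sumPow : v ≤ sumPow ext ∣ J ∣
      v≤sumPow = s≤s⁻¹ (≤-trans visits (^≤1+sumPow ext ∣ J ∣))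
    resume (step {K = K} {ys = zs} a∈ y→z ie rest′) (_ , avoided″) leaves′ rs<fuel
      with track-step {J = J} a∈ y→z ie (tracking (agree-trans s≈x (agree-sym y≈x)) ample) visits
    ... | s′ , s→s′ , inj₁ (refl , tracks) =
      extend {K = J} a∈ y→z s→s′
        (removeCycles fuel rest′ (tail<fuel rs<fuel) (extract-bounded ie) (key J x ∷ vis)
          (Fresh-∷ x-bounded x-fresh below avoided″ leaves′) s′ tracks)
        (λ l budget → ≤-trans (≤-reflexive (sym (+-suc l v))) budget)
    ... | s′ , s→s′ , inj₂ (K<J , tracks) =
      extend {K = K} a∈ y→z s→s′
        (removeCycles fuel rest′ (tail<fuel rs<fuel) (extract-bounded ie) [] (Fresh-[] rest′) s′ tracks)
        (λ l budget → begin
          suc l + v                      ≡⟨ +-suc l v ⟨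
          l + suc v                      ≤⟨ +-mono-≤ (≤-trans (m≤m+n l 0) budget) visits ⟩
          sumPow ext ∣ K ∣ + ext ∣ J ∣ ^ ∣ J ∣ ≤⟨ sumPow-+ ext K<J ⟩
          sumPow ext ∣ J ∣               ∎)
      where open ≤-Reasoning

lemma29 : (d m : ℕ) (ext : ℕ → ℕ) → Extractor d ext → Adapted m d ext →
          (A : List (Action d)) → (∀ a → a ∈ A → ∀ i → pre a i ≤ m) →
          (e : List⁺ (Config d)) → IsExec A e →
          (I : Subset d) → ExtractW ext ⊤ (toList e) I →
          ∃ λ (σ : List (Action d)) → RemovesCycles A I e σ ×
            length σ ≤ d * ext d ^ d ×
            ∃ λ (c : Config d) → Run σ (src e) c ×
              (∀ i → i ∈ₛ I → c i ≡ tgt e i) ×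
              (∀ i → i ∉ I → ext (suc ∣ I ∣) ∸ m * sumPow ext ∣ I ∣ ≤ c i)
lemma29 d m ext extractor adapted A pre≤m (x ∷ xs) exec I extraction
  with ExtractW⇒ExtractL ext extraction
... | _∷_ {J = J} ie exs =
  let σ , (removes , c , run , c≈tgt , high) , budget =
        removeCycles (suc (length xs)) (phased exec exs) ≤-refl (extract-bounded ie) []
          (fresh [] [] (Everywhere-universal (λ _ _ ()) _)) x
          (entering ie (λ _ _ → refl) (λ i i∉⊤ → contradiction ∈⊤ i∉⊤))
  in σ , removes , length≤ σ budget , c , run , c≈tgt , high
  where
  open CycleRemoval m extractor adapted A pre≤m
  length≤ : ∀ σ → length σ + 0 ≤ sumPow ext ∣ J ∣ → length σ ≤ d * ext d ^ d
  length≤ σ budget = begin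
    length σ            ≤⟨ m≤m+n (length σ) 0 ⟩
    length σ + 0        ≤⟨ budget ⟩
    sumPow ext ∣ J ∣     ≤⟨ sumPow≤ extractor (∣p∣≤n J) ⟩
    ∣ J ∣ * ext d ^ d    ≤⟨ *-monoˡ-≤ (ext d ^ d) (∣p∣≤n J) ⟩
    d * ext d ^ d       ∎
    where open ≤-Reasoning
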